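{- Let $A$ be a set of vertices of the $n$-cycle $C_n$. Then $A$ is maximally even if and only if $A$ is a maximizer of $F(X)=\prod_{\{u,v\}\subseteq X,\,u\neq v} d(u,v)$, i.e. $F(A)=\max\{F(B): B\subseteq V(C_n),\ |B|=|A|\}$.
   Context: The vertices of $C_n$ are $0,1,\ldots,n-1$ (integers mod $n$), arranged clockwise, with $u$ adjacent to $u\pm1\bmod n$; $d(u,v)$ is the geodesic distance; the product over unordered pairs is $1$ when empty. The clockwise distance $d^*(u,v)$ is the least non-negative integer congruent to $v-u$ modulo $n$. If $A=\{a_0<\cdots<a_{m-1}\}$, $\mathrm{span}_A(a_i,a_j)$ is the least positive integer congruent to $j-i$ modulo $m$, and for $1\leq k\leq m-1$, $\sigma^*_k(A)=[\,d^*(u,v): u,v\in A,\ u\neq v,\ \mathrm{span}_A(u,v)=k\,]$ (multiset over ordered pairs). $A$ is maximally even if for each $1\leq k\leq m-1$ the set of distinct values in $\sigma^*_k(A)$ is a single integer or two consecutive integers. -}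

module Defs where

open import Data.Nat using (ℕ; zero; suc; _+_; _∸_; _≤_; _<_; _⊓_; NonZero)
open import Data.Nat.DivMod using (_%_)
open import Data.Fin using (Fin; toℕ)
open import Data.Fin.Subset using (Subset; _∈_; ∣_∣)
open import Data.Fin.Subset.Properties using (_∈?_)
open import Data.List using (List; []; _∷_; length; filter; map; allFin; concatMap; lookup)
open import Data.Nat.ListAction using (product)
open import Data.List.Relation.Unary.All using (All)
open import Data.Product using (∃; _×_; _,_)
open import Data.Sum using (_⊎_)
open import Relation.Binary.PropositionalEquality using (_≡_)
open import Relation.Nullary using (¬_)

-- Vertices of C_n are Fin n (integers mod n).

-- clockwise distance d*(u,v): least non-negative integer ≡ v - u (mod n)
dstar : (n : ℕ) .{{_ : NonZero n}} → Fin n → Fin n → ℕ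
dstar n u v = (toℕ v + (n ∸ toℕ u)) % n

dist : (n : ℕ) .{{_ : NonZero n}} → Fin n → Fin n → ℕ
dist n u v = dstar n u v ⊓ dstar n v u

-- the elements of A listed increasingly: a_0 < a_1 < ... < a_{m-1}
elems : {n : ℕ} → Subset n → List (Fin n)
elems A = filter (λ i → i ∈? A) (allFin _)

-- F(X) = product over unordered pairs {u,v} ⊆ X, u ≠ v, of d(u,v)
-- (each unordered pair taken once as (a_i, a_j) with i < j)
F : (n : ℕ) .{{_ : NonZero n}} → Subset n → ℕ
F n X = product
  (concatMap (λ i → concatMap (λ j → pairVal i j) (allFin m)) (allFin m))
  where
    xs = elems X
    m = length xs
    pairVal : Fin m → Fin m → List ℕ
    pairVal i j with toℕ i Data.Nat.<? toℕ j
    ... | Relation.Nullary.yes _ = dist n (lookup xs i) (lookup xs j) ∷ []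
    ... | Relation.Nullary.no _ = []

-- span_A(a_i,a_j) for i ≠ j: least positive integer ≡ j - i (mod m)
-- (for i < j this is j - i, for i > j it is m - (i - j))
spanIdx : (m : ℕ) → Fin m → Fin m → ℕ
spanIdx m i j with toℕ i Data.Nat.<? toℕ j
... | Relation.Nullary.yes _ = toℕ j ∸ toℕ i
... | Relation.Nullary.no _ = m ∸ (toℕ i ∸ toℕ j)

-- σ*_k(A): multiset (as a list) of d*(u,v) over ordered pairs u ≠ v in A
-- with span_A(u,v) = k
sigmaStar : (n : ℕ) .{{_ : NonZero n}} → Subset n → ℕ → List ℕ
sigmaStar n A k = concatMap (λ i → concatMap (λ j → val i j) (allFin m)) (allFin m)
  where
    xs = elems A
    m = length xs
    val : Fin m → Fin m → List ℕ
    val i j with toℕ i Data.Nat.≟ toℕ j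
    ... | Relation.Nullary.yes _ = []
    ... | Relation.Nullary.no _ with spanIdx m i j Data.Nat.≟ k
    ...   | Relation.Nullary.yes _ = dstar n (lookup xs i) (lookup xs j) ∷ []
    ...   | Relation.Nullary.no _ = []

-- A is maximally even: for each 1 ≤ k ≤ m-1 the set of distinct values of
-- σ*_k(A) is a single integer or two consecutive integers, i.e. (the set
-- being nonempty for such k) all values lie in {c, c+1} for some c.
MaximallyEven : (n : ℕ) .{{_ : NonZero n}} → Subset n → Set
MaximallyEven n A = (k : ℕ) → 1 ≤ k → suc k ≤ ∣ A ∣ →
  ∃ λ c → All (λ x → x ≡ c ⊎ x ≡ suc c) (sigmaStar n A k)

IsFMaximizer : (n : ℕ) .{{_ : NonZero n}} → Subset n → Set
IsFMaximizer n A = (B : Subset n) → ∣ B ∣ ≡ ∣ A ∣ → F n B ≤ F n A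

module Submission where

-- Write a₀ < ⋯ < a_{m-1} for the elements of A and, for a span k, let gap k i be the clockwise
-- distance from a_i to a_{i+k mod m}. Every unordered pair {a_i, a_j} occurs once with span j − i
-- and once with span m − (j − i), and d(u, v) = g(d*(u, v)) for g z = min(z, n − z); hence
-- F(A)² = ∏_{k=1}^{m-1} ∏_i g(gap k i). The gaps of span k always sum to k·n, whatever A is.
-- Now g is strictly log-concave on [0, n], so among sequences in [0, n) with a fixed sum the product
-- of the g-values is maximal exactly for sequences taking only two consecutive values c, c + 1.
-- A maximally even set therefore maximises every factor of F(A)². Conversely the set of ⌊i n / m⌋
-- is maximally even, so if some span-k gap of A missed its pair {c, c + 1}, the k-th factor of
-- F(A)² and hence F(A) would be strictly smaller than for that set.

open import Defs
open import Data.Nat using (ℕ; _≤_; NonZero)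
open import Data.Fin.Subset using (Subset)
open import Data.Product using (_×_)

open import Algebra.Bundles using (CommutativeSemigroup)
import Algebra.Properties.CommutativeSemigroup
open import Algebra.Structures using (IsCommutativeMonoid)
open import Data.Empty using (⊥-elim)
open import Data.Fin using (Fin; toℕ; fromℕ<) renaming (zero to fzero; suc to fsuc)
open import Data.Fin.Properties using (toℕ<n; toℕ-fromℕ<)
open import Data.Fin.Subset using (inside; outside; ∣_∣)
open import Data.Fin.Subset.Properties using (_∈?_; ∣p∣≤n)
open import Data.List using (List; []; _∷_; length; filter; map; allFin; tabulate; concatMap; lookup)
open import Data.List.Properties using (length-map; map-tabulate; map-∘)
open import Data.List.Relation.Unary.All using (All; []; _∷_)
open import Data.List.Relation.Unary.All.Properties
  using (concat⁺; concat⁻; map⁺; map⁻; tabulate⁺; tabulate⁻)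
open import Data.Nat
open import Data.Nat.DivMod
open import Data.Nat.Divisibility using (n∣m*n)
open import Data.Nat.ListAction using (product)
open import Data.Nat.ListAction.Properties using (product-++)
open import Data.Nat.Properties
open import Data.Nat.Tactic.RingSolver using (solve-∀)
open import Data.Product using (Σ; _,_; proj₁; proj₂)
open import Data.Sum using (_⊎_; inj₁; inj₂)
open import Data.Vec using (_∷_; [])
open import Function using (_∘_; const; id)
open import Level using (0ℓ)
open import Relation.Binary.Definitions using (tri<; tri≈; tri>)
open import Relation.Binary.PropositionalEquality
open import Relation.Nullary using (¬_; yes; no; Dec)
open import Relation.Nullary.Decidable using (_⊎-dec_; decidable-stable)

module *-CS = Algebra.Properties.CommutativeSemigroup *-commutativeSemigroup
module +-CS = Algebra.Properties.CommutativeSemigroup +-commutativeSemigroup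

-- Products and sums over initial segments of ℕ

module BigOperator {_∙_ : ℕ → ℕ → ℕ} {ε : ℕ} (isCM : IsCommutativeMonoid _≡_ _∙_ ε) where

  open IsCommutativeMonoid isCM using (assoc; identityˡ; isCommutativeSemigroup)

  commutativeSemigroup : CommutativeSemigroup 0ℓ 0ℓ
  commutativeSemigroup = record { isCommutativeSemigroup = isCommutativeSemigroup }

  open Algebra.Properties.CommutativeSemigroup commutativeSemigroup using (interchange)

  big : ℕ → (ℕ → ℕ) → ℕ
  big zero    f = ε
  big (suc l) f = f 0 ∙ big l (f ∘ suc)

  big-cong : ∀ l {f h : ℕ → ℕ} → (∀ i → i < l → f i ≡ h i) → big l f ≡ big l h
  big-cong zero    eq = refl
  big-cong (suc l) eq = cong₂ _∙_ (eq 0 z<s) (big-cong l (λ i → eq (suc i) ∘ s<s))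

  big-split : ∀ k l (f : ℕ → ℕ) → big (k + l) f ≡ big k f ∙ big l (λ i → f (k + i))
  big-split zero    l f = sym (identityˡ _)
  big-split (suc k) l f = trans (cong (f 0 ∙_) (big-split k l (f ∘ suc))) (sym (assoc _ _ _))

  big-distrib : ∀ l (f h : ℕ → ℕ) → big l (λ i → f i ∙ h i) ≡ big l f ∙ big l h
  big-distrib zero    f h = sym (identityˡ ε)
  big-distrib (suc l) f h =
    trans (cong ((f 0 ∙ h 0) ∙_) (big-distrib l (f ∘ suc) (h ∘ suc))) (interchange _ _ _ _)

  big-ε : ∀ l → big l (const ε) ≡ ε
  big-ε zero    = refl
  big-ε (suc l) = trans (identityˡ _) (big-ε l)

  big-swap : ∀ k l (f : ℕ → ℕ → ℕ) →
             big k (λ i → big l (f i)) ≡ big l (λ j → big k (λ i → f i j))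
  big-swap zero    l f = sym (big-ε l)
  big-swap (suc k) l f = trans (cong (big l (f 0) ∙_) (big-swap k l (f ∘ suc)))
                               (sym (big-distrib l (f 0) (λ j → big k (λ i → f (suc i) j))))

open BigOperator *-1-isCommutativeMonoid using () renaming
  (big to ∏; big-cong to ∏-cong; big-split to ∏-split; big-distrib to ∏-distrib; big-swap to ∏-swap)
open BigOperator +-0-isCommutativeMonoid using () renaming
  (big to ∑; big-cong to ∑-cong; big-split to ∑-split; big-distrib to ∑-distrib)

∏-pow : ∀ l k (f : ℕ → ℕ) → ∏ l (λ i → k ^ f i) ≡ k ^ ∑ l f
∏-pow zero    k f = refl
∏-pow (suc l) k f = trans (cong (k ^ f 0 *_) (∏-pow l k (f ∘ suc))) (sym (^-distribˡ-+-* k (f 0) _))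

∏-const : ∀ l k → ∏ l (const k) ≡ k ^ l
∏-const zero    k = refl
∏-const (suc l) k = cong (k *_) (∏-const l k)

∑-const : ∀ l k → ∑ l (const k) ≡ l * k
∑-const zero    k = refl
∑-const (suc l) k = cong (k +_) (∑-const l k)

∏-mono-≤ : ∀ l {f h : ℕ → ℕ} → (∀ i → i < l → f i ≤ h i) → ∏ l f ≤ ∏ l h
∏-mono-≤ zero    le = ≤-refl
∏-mono-≤ (suc l) le = *-mono-≤ (le 0 z<s) (∏-mono-≤ l (λ i → le (suc i) ∘ s<s))

∑-mono-≤ : ∀ l {f h : ℕ → ℕ} → (∀ i → i < l → f i ≤ h i) → ∑ l f ≤ ∑ l h
∑-mono-≤ zero    le = ≤-refl
∑-mono-≤ (suc l) le = +-mono-≤ (le 0 z<s) (∑-mono-≤ l (λ i → le (suc i) ∘ s<s))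

∏-pos : ∀ l {f : ℕ → ℕ} → (∀ i → i < l → 0 < f i) → 0 < ∏ l f
∏-pos zero    pos = z<s
∏-pos (suc l) pos = *-mono-< (pos 0 z<s) (∏-pos l (λ i → pos (suc i) ∘ s<s))

∏-mono-< : ∀ l {f h : ℕ → ℕ} → (∀ i → i < l → f i ≤ h i) → (∀ i → i < l → 0 < h i) →
           ∀ {j} → j < l → f j < h j → ∏ l f < ∏ l h
∏-mono-< (suc l) {f} {h} le pos {zero} _ lt = begin-strict
  f 0 * ∏ l (f ∘ suc)  ≤⟨ *-monoʳ-≤ (f 0) (∏-mono-≤ l (λ i → le (suc i) ∘ s<s)) ⟩
  f 0 * ∏ l (h ∘ suc)  <⟨ *-monoˡ-< (∏ l (h ∘ suc)) {{>-nonZero (∏-pos l (λ i → pos (suc i) ∘ s<s))}}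
                            lt ⟩
  h 0 * ∏ l (h ∘ suc)  ∎
  where open ≤-Reasoning
∏-mono-< (suc l) {f} {h} le pos {suc j} (s<s j<l) lt = begin-strict
  f 0 * ∏ l (f ∘ suc)  ≤⟨ *-monoˡ-≤ (∏ l (f ∘ suc)) (le 0 z<s) ⟩
  h 0 * ∏ l (f ∘ suc)  <⟨ *-monoʳ-< (h 0) {{>-nonZero (pos 0 z<s)}}
                            (∏-mono-< l (λ i → le (suc i) ∘ s<s) (λ i → pos (suc i) ∘ s<s) j<l lt) ⟩
  h 0 * ∏ l (h ∘ suc)  ∎
  where open ≤-Reasoning

suc-*-<-*-suc : ∀ {p q} → q < p → suc p * q < p * suc q
suc-*-<-*-suc {p} {q} q<p = subst (q + p * q <_) (sym (*-suc p q)) (+-monoˡ-< (p * q) q<p)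

square-cancel-≤ : ∀ {p q} → p * p ≤ q * q → p ≤ q
square-cancel-≤ pp≤qq = ≮⇒≥ (λ q<p → <⇒≱ (*-mono-< q<p q<p) pp≤qq)

square-cancel-< : ∀ {p q} → p * p < q * q → p < q
square-cancel-< pp<qq = ≰⇒> (λ q≤p → <⇒≱ pp<qq (*-mono-≤ q≤p q≤p))

∸-+-comm : ∀ z c → (z ∸ c) + c ≡ z + (c ∸ z)
∸-+-comm zero    zero    = refl
∸-+-comm zero    (suc c) = refl
∸-+-comm (suc z) zero    = refl
∸-+-comm (suc z) (suc c) = trans (+-suc (z ∸ c) c) (cong suc (∸-+-comm z c))

Near : ℕ → ℕ → Set
Near c x = x ≡ c ⊎ x ≡ suc c

Near? : ∀ c x → Dec (Near c x)
Near? c x = x ≟ c ⊎-dec x ≟ suc c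

Near⇒≤ : ∀ {c x} → Near c x → c ≤ x
Near⇒≤ (inj₁ refl) = ≤-refl
Near⇒≤ (inj₂ refl) = n≤1+n _

bounds⇒Near : ∀ {c x} → c ≤ x → x < 2 + c → Near c x
bounds⇒Near c≤x x<2+c with m≤n⇒m<n∨m≡n c≤x
... | inj₁ c<x = inj₂ (≤-antisym (s≤s⁻¹ x<2+c) c<x)
... | inj₂ c≡x = inj₁ (sym c≡x)

Near-cancelˡ : ∀ a {c x} → Near (a + c) (a + x) → Near c x
Near-cancelˡ a     (inj₁ e) = inj₁ (+-cancelˡ-≡ a _ _ e)
Near-cancelˡ a {c} (inj₂ e) = inj₂ (+-cancelˡ-≡ a _ _ (trans e (sym (+-suc a c))))

module _ (m : ℕ) .{{_ : NonZero m}} where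

  m*n≤o⇒m≤o/n : ∀ {q z} → q * m ≤ z → q ≤ z / m
  m*n≤o⇒m≤o/n {q} {z} qm≤z = subst (_≤ z / m) (m*n/n≡m q m) (/-monoˡ-≤ m qm≤z)

  m<[1+m/n]*n : ∀ z → z < suc (z / m) * m
  m<[1+m/n]*n z = subst (_< m + z / m * m) (sym (m≡m%n+[m/n]*n z m)) (+-monoˡ-< (z / m * m) (m%n<n z m))

  [m+n]/o-Near : ∀ z w → Near (z / m + w / m) ((z + w) / m)
  [m+n]/o-Near z w = bounds⇒Near lower upper
    where
      lower : z / m + w / m ≤ (z + w) / m
      lower = m*n≤o⇒m≤o/n (subst (_≤ z + w) (sym (*-distribʳ-+ m (z / m) (w / m)))
                                 (+-mono-≤ (m/n*n≤m z m) (m/n*n≤m w m)))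
      [2+z/m+w/m]*m : suc (z / m) * m + suc (w / m) * m ≡ (2 + (z / m + w / m)) * m
      [2+z/m+w/m]*m = trans (sym (*-distribʳ-+ m (suc (z / m)) (suc (w / m))))
                            (cong (λ s → suc s * m) (+-suc (z / m) (w / m)))
      upper : (z + w) / m < 2 + (z / m + w / m)
      upper = m<n*o⇒m/o<n (subst (z + w <_) [2+z/m+w/m]*m (+-mono-< (m<[1+m/n]*n z) (m<[1+m/n]*n w)))

-- Log-concavity of the shorter arc

module ShortArc (n : ℕ) where

  open ≤-Reasoning

  shortArc : ℕ → ℕ
  shortArc z = z ⊓ (n ∸ z)

  shortArc-pos : ∀ {z} → 1 ≤ z → z < n → 0 < shortArc z
  shortArc-pos 1≤z z<n = ⊓-glb 1≤z (m<n⇒0<n∸m z<n)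

  -- The right-hand side is one of four products of arms of the two minima, and each of them
  -- strictly exceeds a product of arms of the minima on the left.
  shortArc-logConcave-< : ∀ {x y} → y < x → suc x ≤ n →
                          shortArc (suc x) * shortArc y < shortArc x * shortArc (suc y)
  shortArc-logConcave-< {x} {y} y<x sx≤n with ⊓-sel x (n ∸ x) | ⊓-sel (suc y) (n ∸ suc y)
  ... | inj₁ arc[x]≡x | inj₁ arc[sy]≡sy = begin-strict
    shortArc (suc x) * shortArc y  ≤⟨ *-mono-≤ (m⊓n≤m (suc x) (n ∸ suc x)) (m⊓n≤m y (n ∸ y)) ⟩
    suc x * y                      <⟨ suc-*-<-*-suc y<x ⟩
    x * suc y                      ≡⟨ cong₂ _*_ arc[x]≡x arc[sy]≡sy ⟨
    shortArc x * shortArc (suc y)  ∎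
  ... | inj₁ arc[x]≡x | inj₂ arc[sy]≡n-sy = begin-strict
    shortArc (suc x) * shortArc y  ≤⟨ *-mono-≤ (m⊓n≤n (suc x) (n ∸ suc x)) (m⊓n≤m y (n ∸ y)) ⟩
    (n ∸ suc x) * y                <⟨ *-mono-< (∸-monoʳ-< (s<s y<x) sx≤n) y<x ⟩
    (n ∸ suc y) * x                ≡⟨ *-comm (n ∸ suc y) x ⟩
    x * (n ∸ suc y)                ≡⟨ cong₂ _*_ arc[x]≡x arc[sy]≡n-sy ⟨
    shortArc x * shortArc (suc y)  ∎
  ... | inj₂ arc[x]≡n-x | inj₁ arc[sy]≡sy = begin-strict
    shortArc (suc x) * shortArc y  ≤⟨ *-mono-≤ (m⊓n≤n (suc x) (n ∸ suc x)) (m⊓n≤m y (n ∸ y)) ⟩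
    (n ∸ suc x) * y                <⟨ *-mono-< (∸-monoʳ-< (n<1+n x) sx≤n) (n<1+n y) ⟩
    (n ∸ x) * suc y                ≡⟨ cong₂ _*_ arc[x]≡n-x arc[sy]≡sy ⟨
    shortArc x * shortArc (suc y)  ∎
  ... | inj₂ arc[x]≡n-x | inj₂ arc[sy]≡n-sy = begin-strict
    shortArc (suc x) * shortArc y  ≤⟨ *-mono-≤ (m⊓n≤n (suc x) (n ∸ suc x)) (m⊓n≤n y (n ∸ y)) ⟩
    q * (n ∸ y)                    ≡⟨ cong (q *_) (+-∸-assoc 1 sy≤n) ⟩
    q * suc p                      ≡⟨ *-comm q (suc p) ⟩
    suc p * q                      <⟨ suc-*-<-*-suc (∸-monoʳ-< (s<s y<x) sx≤n) ⟩
    p * suc q                      ≡⟨ *-comm p (suc q) ⟩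
    suc q * p                      ≡⟨ cong₂ _*_ (trans arc[x]≡n-x (+-∸-assoc 1 sx≤n)) arc[sy]≡n-sy ⟨
    shortArc x * shortArc (suc y)  ∎
    where
      p q : ℕ
      p = n ∸ suc y
      q = n ∸ suc x
      sy≤n : suc y ≤ n
      sy≤n = ≤-trans y<x (≤-trans (n≤1+n x) sx≤n)

  shortArc-logConcave : ∀ {x y} → y ≤ x → suc x ≤ n →
                        shortArc (suc x) * shortArc y ≤ shortArc x * shortArc (suc y)
  shortArc-logConcave {x} y≤x sx≤n with m≤n⇒m<n∨m≡n y≤x
  ... | inj₁ y<x  = <⇒≤ (shortArc-logConcave-< y<x sx≤n)
  ... | inj₂ refl = ≤-reflexive (*-comm (shortArc (suc x)) (shortArc x))

record Centred (n l : ℕ) (y : ℕ → ℕ) : Set where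
  field
    centre     : ℕ
    1≤centre   : 1 ≤ centre
    2+centre≤n : 2 + centre ≤ n
    near       : ∀ i → i < l → Near centre (y i)

-- Interpolation around c needs shortArc c and shortArc (c + 1) nonzero, i.e. 1 ≤ c ≤ n − 2;
-- values in [1, n) leave room to move c there.
recentre : ∀ {n l c} {y : ℕ → ℕ} → 3 ≤ n → 0 < l →
           (∀ i → i < l → 1 ≤ y i) → (∀ i → i < l → y i < n) → (∀ i → i < l → Near c (y i)) →
           Centred n l y
recentre {n} {l} {zero} {y} 3≤n _ 1≤y _ near = record
  { centre = 1 ; 1≤centre = ≤-refl ; 2+centre≤n = 3≤n ; near = near₁ }
  where
    near₁ : ∀ i → i < l → Near 1 (y i)
    near₁ i i<l with near i i<l
    ... | inj₁ y≡0 = ⊥-elim (<⇒≢ (1≤y i i<l) (sym y≡0))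
    ... | inj₂ y≡1 = inj₁ y≡1
recentre {n} {l} {suc c} {y} 3≤n 0<l _ y<n near with 3 + c ≤? n
... | yes 3+c≤n = record { centre = suc c ; 1≤centre = s≤s z≤n ; 2+centre≤n = 3+c≤n ; near = near }
... | no  3+c≰n = record
  { centre = c ; 1≤centre = 1≤c ; 2+centre≤n = ≤-reflexive (sym n≡2+c) ; near = near₋ }
  where
    n≤2+c : n ≤ 2 + c
    n≤2+c = ≤-pred (≰⇒> 3+c≰n)
    y≡1+c : ∀ i → i < l → y i ≡ suc c
    y≡1+c i i<l with near i i<l
    ... | inj₁ y≡1+c = y≡1+c
    ... | inj₂ y≡2+c = ⊥-elim (<⇒≱ (y<n i i<l) (≤-trans n≤2+c (≤-reflexive (sym y≡2+c))))
    n≡2+c : n ≡ 2 + c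
    n≡2+c = ≤-antisym n≤2+c (subst (_< n) (y≡1+c 0 0<l) (y<n 0 0<l))
    1≤c : 1 ≤ c
    1≤c = ≤-pred (≤-pred (subst (3 ≤_) n≡2+c 3≤n))
    near₋ : ∀ i → i < l → Near c (y i)
    near₋ i i<l = inj₂ (y≡1+c i i<l)

-- By log-concavity shortArc lies below the geometric sequence through its values b at c and a at
-- c + 1: shortArc x · weight x ≤ bound x says shortArc x ≤ b (a / b)^(x − c) for x ≥ c and
-- shortArc x ≤ b (b / a)^(c − x) for x ≤ c, with equality at c and c + 1. Over a sequence with sum
-- l c + E, the product of the weights and that of the bounds differ from b^E and b^l a^E by the
-- same factor, so the product of the shortArc-values is at most b^(l − E) a^E, attained exactly by
-- the sequences with values in {c, c + 1}.
module Interpolation (n c : ℕ) (1≤c : 1 ≤ c) (2+c≤n : 2 + c ≤ n) where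

  open ShortArc n
  open ≤-Reasoning

  b a : ℕ
  b = shortArc c
  a = shortArc (suc c)

  instance
    b≢0 : NonZero b
    b≢0 = >-nonZero (shortArc-pos 1≤c (≤-trans (n≤1+n (suc c)) 2+c≤n))
    a≢0 : NonZero a
    a≢0 = >-nonZero (shortArc-pos (s≤s z≤n) 2+c≤n)

  ascend : ∀ u v t → u * b ≤ v * a → v * b ^ t ≤ b * a ^ t → u * b ^ suc t ≤ b * a ^ suc t
  ascend u v t ub≤va vbᵗ≤baᵗ = begin
    u * (b * b ^ t)  ≡⟨ *-assoc u b (b ^ t) ⟨
    u * b * b ^ t    ≤⟨ *-monoˡ-≤ (b ^ t) ub≤va ⟩
    v * a * b ^ t    ≡⟨ *-CS.xy∙z≈y∙xz v a (b ^ t) ⟩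
    a * (v * b ^ t)  ≤⟨ *-monoʳ-≤ a vbᵗ≤baᵗ ⟩
    a * (b * a ^ t)  ≡⟨ *-CS.x∙yz≈y∙xz a b (a ^ t) ⟩
    b * (a * a ^ t)  ∎

  ascend-< : ∀ u v t → u * b < v * a → v * b ^ t ≤ b * a ^ t → u * b ^ suc t < b * a ^ suc t
  ascend-< u v t ub<va vbᵗ≤baᵗ = begin-strict
    u * (b * b ^ t)  ≡⟨ *-assoc u b (b ^ t) ⟨
    u * b * b ^ t    <⟨ *-monoˡ-< (b ^ t) {{m^n≢0 b t}} ub<va ⟩
    v * a * b ^ t    ≡⟨ *-CS.xy∙z≈y∙xz v a (b ^ t) ⟩
    a * (v * b ^ t)  ≤⟨ *-monoʳ-≤ a vbᵗ≤baᵗ ⟩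
    a * (b * a ^ t)  ≡⟨ *-CS.x∙yz≈y∙xz a b (a ^ t) ⟩
    b * (a * a ^ t)  ∎

  descend : ∀ u v t → a * u ≤ b * v → v * a ^ t ≤ b ^ suc t → u * a ^ suc t ≤ b ^ suc (suc t)
  descend u v t au≤bv vaᵗ≤bᵗ⁺¹ = begin
    u * (a * a ^ t)  ≡⟨ *-CS.x∙yz≈yx∙z u a (a ^ t) ⟩
    a * u * a ^ t    ≤⟨ *-monoˡ-≤ (a ^ t) au≤bv ⟩
    b * v * a ^ t    ≡⟨ *-assoc b v (a ^ t) ⟩
    b * (v * a ^ t)  ≤⟨ *-monoʳ-≤ b vaᵗ≤bᵗ⁺¹ ⟩
    b ^ suc (suc t)  ∎

  descend-< : ∀ u v t → a * u < b * v → v * a ^ t ≤ b ^ suc t → u * a ^ suc t < b ^ suc (suc t)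
  descend-< u v t au<bv vaᵗ≤bᵗ⁺¹ = begin-strict
    u * (a * a ^ t)  ≡⟨ *-CS.x∙yz≈yx∙z u a (a ^ t) ⟩
    a * u * a ^ t    <⟨ *-monoˡ-< (a ^ t) {{m^n≢0 a t}} au<bv ⟩
    b * v * a ^ t    ≡⟨ *-assoc b v (a ^ t) ⟩
    b * (v * a ^ t)  ≤⟨ *-monoʳ-≤ b vaᵗ≤bᵗ⁺¹ ⟩
    b ^ suc (suc t)  ∎

  above : ∀ t → t + c < n → shortArc (t + c) * b ^ t ≤ b * a ^ t
  above zero    _  = ≤-refl
  above (suc t) lt = ascend (shortArc (suc t + c)) (shortArc (t + c)) t
    (shortArc-logConcave {t + c} (m≤n+m c t) (<⇒≤ lt)) (above t (<-trans (n<1+n _) lt))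

  above-< : ∀ t → 2 + t + c < n → shortArc (2 + t + c) * b ^ (2 + t) < b * a ^ (2 + t)
  above-< t lt = ascend-< (shortArc (2 + t + c)) (shortArc (suc t + c)) (suc t)
    (shortArc-logConcave-< {suc t + c} (s≤s (m≤n+m c t)) (<⇒≤ lt)) (above (suc t) (<-trans (n<1+n _) lt))

  below : ∀ y t → y + t ≡ c → shortArc y * a ^ t ≤ b ^ suc t
  below y zero    y+0≡c = ≤-reflexive (cong (λ z → shortArc z * 1) (trans (sym (+-identityʳ y)) y+0≡c))
  below y (suc t) y+t+1≡c = descend (shortArc y) (shortArc (suc y)) t
    (shortArc-logConcave {c} y≤c (≤-trans (n≤1+n _) 2+c≤n))
    (below (suc y) t (trans (sym (+-suc y t)) y+t+1≡c))
    where
      y≤c : y ≤ c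
      y≤c = subst (y ≤_) y+t+1≡c (m≤m+n y (suc t))

  below-< : ∀ y t → y + suc t ≡ c → shortArc y * a ^ suc t < b ^ suc (suc t)
  below-< y t y+t+1≡c = descend-< (shortArc y) (shortArc (suc y)) t
    (shortArc-logConcave-< {c} y<c (≤-trans (n≤1+n _) 2+c≤n))
    (below (suc y) t (trans (sym (+-suc y t)) y+t+1≡c))
    where
      y<c : y < c
      y<c = subst (y <_) y+t+1≡c (m<m+n y z<s)

  weight bound : ℕ → ℕ
  weight x = b ^ (x ∸ c) * a ^ (c ∸ x)
  bound  x = b * (a ^ (x ∸ c) * b ^ (c ∸ x))

  weight-above : ∀ t → weight (t + c) ≡ b ^ t
  weight-above t rewrite m+n∸n≡m t c | m≤n⇒m∸n≡0 (m≤n+m c t) = *-identityʳ (b ^ t)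

  bound-above : ∀ t → bound (t + c) ≡ b * a ^ t
  bound-above t rewrite m+n∸n≡m t c | m≤n⇒m∸n≡0 (m≤n+m c t) = cong (b *_) (*-identityʳ (a ^ t))

  exponents-below : ∀ y t → y + t ≡ c → y ∸ c ≡ 0 × c ∸ y ≡ t
  exponents-below y t y+t≡c =
    m≤n⇒m∸n≡0 (subst (y ≤_) y+t≡c (m≤m+n y t)) , trans (cong (_∸ y) (sym y+t≡c)) (m+n∸m≡n y t)

  weight-below : ∀ y t → y + t ≡ c → weight y ≡ a ^ t
  weight-below y t y+t≡c with exponents-below y t y+t≡c
  ... | y∸c≡0 , c∸y≡t rewrite y∸c≡0 | c∸y≡t = *-identityˡ (a ^ t)

  bound-below : ∀ y t → y + t ≡ c → bound y ≡ b ^ suc t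
  bound-below y t y+t≡c with exponents-below y t y+t≡c
  ... | y∸c≡0 , c∸y≡t rewrite y∸c≡0 | c∸y≡t = cong (b *_) (*-identityˡ (b ^ t))

  via-above : ∀ {R : ℕ → ℕ → Set} t → R (shortArc (t + c) * b ^ t) (b * a ^ t) →
              R (shortArc (t + c) * weight (t + c)) (bound (t + c))
  via-above {R} t = subst₂ (λ w v → R (shortArc (t + c) * w) v) (sym (weight-above t)) (sym (bound-above t))

  via-below : ∀ {R : ℕ → ℕ → Set} y t → y + t ≡ c → R (shortArc y * a ^ t) (b ^ suc t) →
              R (shortArc y * weight y) (bound y)
  via-below {R} y t y+t≡c =
    subst₂ (λ w v → R (shortArc y * w) v) (sym (weight-below y t y+t≡c)) (sym (bound-below y t y+t≡c))

  data Side : ℕ → Set where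
    at-or-above    : ∀ t → Side (t + c)
    strictly-below : ∀ y t → y + suc t ≡ c → Side y

  side : ∀ x → Side x
  side x with c ≤? x
  ... | yes c≤x = subst Side (m∸n+n≡m c≤x) (at-or-above (x ∸ c))
  ... | no  c≰x = strictly-below x (c ∸ suc x) (trans (+-suc x _) (m+[n∸m]≡n (≰⇒> c≰x)))

  interpolation-≤ : ∀ {x} → x < n → shortArc x * weight x ≤ bound x
  interpolation-≤ {x} x<n with side x
  ... | at-or-above t          = via-above {_≤_} t (above t x<n)
  ... | strictly-below .x t eq = via-below {_≤_} x (suc t) eq (below x (suc t) eq)

  interpolation-≡ : ∀ {x} → Near c x → shortArc x * weight x ≡ bound x
  interpolation-≡ (inj₁ refl) = via-above {_≡_} 0 refl
  interpolation-≡ (inj₂ refl) = via-above {_≡_} 1 (*-CS.x∙yz≈y∙xz a b 1)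

  interpolation-< : ∀ {x} → x < n → ¬ Near c x → shortArc x * weight x < bound x
  interpolation-< {x} x<n ¬near with side x
  ... | at-or-above 0             = ⊥-elim (¬near (inj₁ refl))
  ... | at-or-above 1             = ⊥-elim (¬near (inj₂ refl))
  ... | at-or-above (suc (suc t)) = via-above {_<_} (2 + t) (above-< t x<n)
  ... | strictly-below .x t eq    = via-below {_<_} x (suc t) eq (below-< x t eq)

  bound-pos : ∀ x → 0 < bound x
  bound-pos x = *-mono-< (>-nonZero⁻¹ b) (*-mono-< (m^n>0 a (x ∸ c)) (m^n>0 b (c ∸ x)))

  excess : ∀ l (x : ℕ → ℕ) {E} → ∑ l x ≡ l * c + E →
           ∑ l (λ i → x i ∸ c) ≡ ∑ l (λ i → c ∸ x i) + E
  excess l x {E} ∑x≡lc+E = +-cancelʳ-≡ (l * c) _ _ (begin-equality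
    U + l * c                     ≡⟨ cong (U +_) (∑-const l c) ⟨
    U + ∑ l (const c)             ≡⟨ ∑-distrib l _ _ ⟨
    ∑ l (λ i → (x i ∸ c) + c)     ≡⟨ ∑-cong l (λ i _ → ∸-+-comm (x i) c) ⟩
    ∑ l (λ i → x i + (c ∸ x i))   ≡⟨ ∑-distrib l _ _ ⟩
    ∑ l x + D                     ≡⟨ cong (_+ D) ∑x≡lc+E ⟩
    l * c + E + D                 ≡⟨ +-CS.xy∙z≈zy∙x (l * c) E D ⟩
    D + E + l * c                 ∎)
    where
      U D : ℕ
      U = ∑ l (λ i → x i ∸ c)
      D = ∑ l (λ i → c ∸ x i)

  private
    regroup : ∀ p q r s → p * (q * r * s) ≡ p * r * (q * s)
    regroup = solve-∀

  module _ {l} {x : ℕ → ℕ} {E} (∑x≡lc+E : ∑ l x ≡ l * c + E) where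

    private
      U D P : ℕ
      U = ∑ l (λ i → x i ∸ c)
      D = ∑ l (λ i → c ∸ x i)
      P = ∏ l (shortArc ∘ x)
      U≡D+E : U ≡ D + E
      U≡D+E = excess l x ∑x≡lc+E
      instance
        K≢0 : NonZero (b ^ D * a ^ D)
        K≢0 = m*n≢0 (b ^ D) (a ^ D) {{m^n≢0 b D}} {{m^n≢0 a D}}

    ∏-weighted : ∏ l (λ i → shortArc (x i) * weight (x i)) ≡ P * b ^ E * (b ^ D * a ^ D)
    ∏-weighted = begin-equality
      ∏ l (λ i → shortArc (x i) * weight (x i))  ≡⟨ ∏-distrib l _ _ ⟩
      P * ∏ l (weight ∘ x)                       ≡⟨ cong (P *_) (∏-distrib l _ _) ⟩
      P * (∏ l (λ i → b ^ (x i ∸ c)) * ∏ l (λ i → a ^ (c ∸ x i)))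
        ≡⟨ cong₂ (λ u v → P * (u * v)) (∏-pow l b _) (∏-pow l a _) ⟩
      P * (b ^ U * a ^ D)                        ≡⟨ cong (λ u → P * (b ^ u * a ^ D)) U≡D+E ⟩
      P * (b ^ (D + E) * a ^ D)                  ≡⟨ cong (λ w → P * (w * a ^ D)) (^-distribˡ-+-* b D E) ⟩
      P * (b ^ D * b ^ E * a ^ D)                ≡⟨ regroup P (b ^ D) (b ^ E) (a ^ D) ⟩
      P * b ^ E * (b ^ D * a ^ D)                ∎

    ∏-bound : ∏ l (bound ∘ x) ≡ b ^ l * a ^ E * (b ^ D * a ^ D)
    ∏-bound = begin-equality
      ∏ l (bound ∘ x)                        ≡⟨ ∏-distrib l _ _ ⟩
      ∏ l (const b) * ∏ l (λ i → a ^ (x i ∸ c) * b ^ (c ∸ x i))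
        ≡⟨ cong₂ _*_ (∏-const l b) (∏-distrib l _ _) ⟩
      b ^ l * (∏ l (λ i → a ^ (x i ∸ c)) * ∏ l (λ i → b ^ (c ∸ x i)))
        ≡⟨ cong₂ (λ u v → b ^ l * (u * v)) (∏-pow l a _) (∏-pow l b _) ⟩
      b ^ l * (a ^ U * b ^ D)                ≡⟨ cong (λ u → b ^ l * (a ^ u * b ^ D)) U≡D+E ⟩
      b ^ l * (a ^ (D + E) * b ^ D)          ≡⟨ cong (λ w → b ^ l * (w * b ^ D)) (^-distribˡ-+-* a D E) ⟩
      b ^ l * (a ^ D * a ^ E * b ^ D)        ≡⟨ regroup (b ^ l) (a ^ D) (a ^ E) (b ^ D) ⟩
      b ^ l * a ^ E * (a ^ D * b ^ D)        ≡⟨ cong (b ^ l * a ^ E *_) (*-comm (a ^ D) (b ^ D)) ⟩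
      b ^ l * a ^ E * (b ^ D * a ^ D)        ∎

    ∏-shortArc-≤ : (∀ i → i < l → x i < n) → P * b ^ E ≤ b ^ l * a ^ E
    ∏-shortArc-≤ x<n = *-cancelʳ-≤ _ _ (b ^ D * a ^ D) (subst₂ _≤_ ∏-weighted ∏-bound
      (∏-mono-≤ l (λ i i<l → interpolation-≤ (x<n i i<l))))

    ∏-shortArc-≡ : (∀ i → i < l → Near c (x i)) → P * b ^ E ≡ b ^ l * a ^ E
    ∏-shortArc-≡ near = *-cancelʳ-≡ _ _ (b ^ D * a ^ D) (trans (sym ∏-weighted)
      (trans (∏-cong l (λ i i<l → interpolation-≡ (near i i<l))) ∏-bound))

    ∏-shortArc-< : (∀ i → i < l → x i < n) → ∀ {j} → j < l → ¬ Near c (x j) →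
                   P * b ^ E < b ^ l * a ^ E
    ∏-shortArc-< x<n j<l ¬near = *-cancelʳ-< (b ^ D * a ^ D) _ _ (subst₂ _<_ ∏-weighted ∏-bound
      (∏-mono-< l (λ i i<l → interpolation-≤ (x<n i i<l)) (λ i _ → bound-pos (x i))
                j<l (interpolation-< (x<n _ j<l) ¬near)))

  module _ {l} {x y : ℕ → ℕ} (x<n : ∀ i → i < l → x i < n) (y-near : ∀ i → i < l → Near c (y i))
           (∑x≡∑y : ∑ l x ≡ ∑ l y) where

    private
      E : ℕ
      E = ∑ l y ∸ l * c
      lc≤∑y : l * c ≤ ∑ l y
      lc≤∑y = subst (_≤ ∑ l y) (∑-const l c) (∑-mono-≤ l (λ i i<l → Near⇒≤ (y-near i i<l)))
      ∑y≡lc+E : ∑ l y ≡ l * c + E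
      ∑y≡lc+E = sym (m+[n∸m]≡n lc≤∑y)
      ∑x≡lc+E : ∑ l x ≡ l * c + E
      ∑x≡lc+E = trans ∑x≡∑y ∑y≡lc+E
      instance
        bᴱ≢0 : NonZero (b ^ E)
        bᴱ≢0 = m^n≢0 b E

    balanced-maximizes-∏ : ∏ l (shortArc ∘ x) ≤ ∏ l (shortArc ∘ y)
    balanced-maximizes-∏ = *-cancelʳ-≤ _ _ (b ^ E)
      (≤-trans (∏-shortArc-≤ ∑x≡lc+E x<n) (≤-reflexive (sym (∏-shortArc-≡ ∑y≡lc+E y-near))))

    balanced-maximizes-∏-strictly : ∀ {j} → j < l → ¬ Near c (x j) →
                                    ∏ l (shortArc ∘ x) < ∏ l (shortArc ∘ y)
    balanced-maximizes-∏-strictly j<l ¬near = *-cancelʳ-< (b ^ E) _ _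
      (<-≤-trans (∏-shortArc-< ∑x≡lc+E x<n j<l ¬near)
                 (≤-reflexive (sym (∏-shortArc-≡ ∑y≡lc+E y-near))))

-- Clockwise distance and cyclic indices

module Clockwise (n : ℕ) .{{_ : NonZero n}} where

  open ShortArc n

  clockwise : ℕ → ℕ → ℕ
  clockwise x y = (y + (n ∸ x)) % n

  clockwise<n : ∀ x y → clockwise x y < n
  clockwise<n x y = m%n<n (y + (n ∸ x)) n

  clockwise-≤ : ∀ {x y} → x ≤ y → y < n → clockwise x y ≡ y ∸ x
  clockwise-≤ {x} {y} x≤y y<n = begin
    (y + (n ∸ x)) % n  ≡⟨ cong (_% n) (+-∸-assoc y x≤n) ⟨
    (y + n ∸ x) % n    ≡⟨ cong (_% n) (+-∸-comm n x≤y) ⟩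
    (y ∸ x + n) % n    ≡⟨ [m+n]%n≡m%n (y ∸ x) n ⟩
    (y ∸ x) % n        ≡⟨ m<n⇒m%n≡m (≤-<-trans (m∸n≤m y x) y<n) ⟩
    y ∸ x              ∎
    where
      open ≡-Reasoning
      x≤n : x ≤ n
      x≤n = ≤-trans x≤y (<⇒≤ y<n)

  clockwise-> : ∀ {x y} → y < x → x < n → clockwise x y ≡ y + (n ∸ x)
  clockwise-> {x} {y} y<x x<n =
    m<n⇒m%n≡m (subst (y + (n ∸ x) <_) (m+[n∸m]≡n (<⇒≤ x<n)) (+-monoˡ-< (n ∸ x) y<x))

  clockwise-+-≤ : ∀ {x y} → x ≤ y → y < n → clockwise x y + x ≡ y
  clockwise-+-≤ x≤y y<n = trans (cong (_+ _) (clockwise-≤ x≤y y<n)) (m∸n+n≡m x≤y)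

  clockwise-+-> : ∀ {x y} → y < x → x < n → clockwise x y + x ≡ y + n
  clockwise-+-> {x} {y} y<x x<n = begin
    clockwise x y + x    ≡⟨ cong (_+ x) (clockwise-> y<x x<n) ⟩
    y + (n ∸ x) + x      ≡⟨ +-assoc y (n ∸ x) x ⟩
    y + (n ∸ x + x)      ≡⟨ cong (y +_) (m∸n+n≡m (<⇒≤ x<n)) ⟩
    y + n                ∎
    where open ≡-Reasoning

  clockwise-+-clockwise-< : ∀ {x y} → x < y → y < n → clockwise x y + clockwise y x ≡ n
  clockwise-+-clockwise-< {x} {y} x<y y<n = begin
    clockwise x y + clockwise y x  ≡⟨ cong₂ _+_ (clockwise-≤ (<⇒≤ x<y) y<n) (clockwise-> x<y y<n) ⟩
    (y ∸ x) + (x + (n ∸ y))        ≡⟨ +-assoc (y ∸ x) x (n ∸ y) ⟨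
    (y ∸ x) + x + (n ∸ y)          ≡⟨ cong (_+ (n ∸ y)) (m∸n+n≡m (<⇒≤ x<y)) ⟩
    y + (n ∸ y)                    ≡⟨ m+[n∸m]≡n (<⇒≤ y<n) ⟩
    n                              ∎
    where open ≡-Reasoning

  clockwise-+-clockwise : ∀ {x y} → x ≢ y → x < n → y < n → clockwise x y + clockwise y x ≡ n
  clockwise-+-clockwise {x} {y} x≢y x<n y<n with <-cmp x y
  ... | tri< x<y _ _ = clockwise-+-clockwise-< x<y y<n
  ... | tri≈ _ x≡y _ = ⊥-elim (x≢y x≡y)
  ... | tri> _ _ y<x = trans (+-comm (clockwise x y) (clockwise y x)) (clockwise-+-clockwise-< y<x x<n)

  clockwise-pos : ∀ {x y} → x ≢ y → x < n → y < n → 0 < clockwise x y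
  clockwise-pos {x} {y} x≢y x<n y<n = n≢0⇒n>0 λ d≡0 → <-irrefl (clockwise-+-clockwise x≢y x<n y<n)
    (subst (_< n) (cong (_+ clockwise y x) (sym d≡0)) (clockwise<n y x))

  geodesic≡shortArc : ∀ {x y} → x ≢ y → x < n → y < n →
                      clockwise x y ⊓ clockwise y x ≡ shortArc (clockwise x y)
  geodesic≡shortArc {x} {y} x≢y x<n y<n = cong (clockwise x y ⊓_) (begin
    clockwise y x                                  ≡⟨ m+n∸m≡n (clockwise x y) (clockwise y x) ⟨
    clockwise x y + clockwise y x ∸ clockwise x y
      ≡⟨ cong (_∸ clockwise x y) (clockwise-+-clockwise x≢y x<n y<n) ⟩
    n ∸ clockwise x y                              ∎)
    where open ≡-Reasoning

data AddMod (m i k j : ℕ) : Set where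
  no-wrap : i + k ≡ j     → AddMod m i k j
  wrap    : i + k ≡ j + m → AddMod m i k j

module CyclicIndex (m : ℕ) where

  private
    wrapped : ∀ {j j′} → j ≡ j′ + m → m ≤ j
    wrapped {j′ = j′} j≡j′+m = subst (m ≤_) (sym j≡j′+m) (m≤n+m m j′)

    excess-m : ∀ {i k k′ j} → i + k ≡ j → i + k′ ≡ j + m → k′ ≡ k + m
    excess-m {i} {k} {k′} e e′ =
      +-cancelˡ-≡ i k′ (k + m) (trans e′ (trans (cong (_+ m) (sym e)) (+-assoc i k m)))

  addMod-unique : ∀ {i k j j′} → AddMod m i k j → AddMod m i k j′ → j < m → j′ < m → j ≡ j′
  addMod-unique (no-wrap e) (no-wrap e′) _   _    = trans (sym e) e′
  addMod-unique (wrap e)    (wrap e′)    _   _    = +-cancelʳ-≡ _ _ _ (trans (sym e) e′)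
  addMod-unique (no-wrap e) (wrap e′)    j<m _    = ⊥-elim (<⇒≱ j<m (wrapped (trans (sym e) e′)))
  addMod-unique (wrap e)    (no-wrap e′) _   j′<m = ⊥-elim (<⇒≱ j′<m (wrapped (trans (sym e′) e)))

  addMod-cancel : ∀ {i k k′ j} → AddMod m i k j → AddMod m i k′ j → k < m → k′ < m → k ≡ k′
  addMod-cancel (no-wrap e) (no-wrap e′) _   _    = +-cancelˡ-≡ _ _ _ (trans e (sym e′))
  addMod-cancel (wrap e)    (wrap e′)    _   _    = +-cancelˡ-≡ _ _ _ (trans e (sym e′))
  addMod-cancel (no-wrap e) (wrap e′)    _   k′<m = ⊥-elim (<⇒≱ k′<m (wrapped (excess-m e e′)))
  addMod-cancel (wrap e)    (no-wrap e′) k<m _    = ⊥-elim (<⇒≱ k<m (wrapped (excess-m e′ e)))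

  shift : ℕ → ℕ → ℕ
  shift k i with i + k <? m
  ... | yes _ = i + k
  ... | no  _ = i + k ∸ m

  shift-< : ∀ {k i} → i + k < m → shift k i ≡ i + k
  shift-< {k} {i} i+k<m with i + k <? m
  ... | yes _     = refl
  ... | no  i+k≮m = ⊥-elim (i+k≮m i+k<m)

  shift-≥ : ∀ {k i} → m ≤ i + k → shift k i ≡ i + k ∸ m
  shift-≥ {k} {i} m≤i+k with i + k <? m
  ... | yes i+k<m = ⊥-elim (<⇒≱ i+k<m m≤i+k)
  ... | no  _     = refl

  shift-addMod : ∀ k i → AddMod m i k (shift k i)
  shift-addMod k i with i + k <? m
  ... | yes _     = no-wrap refl
  ... | no  i+k≮m = wrap (sym (m∸n+n≡m (≮⇒≥ i+k≮m)))

  shift<m : ∀ {k i} → k < m → i < m → shift k i < m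
  shift<m {k} {i} k<m i<m with i + k <? m
  ... | yes i+k<m = i+k<m
  ... | no  i+k≮m = +-cancelʳ-< m (i + k ∸ m) m
                      (subst (_< m + m) (sym (m∸n+n≡m (≮⇒≥ i+k≮m))) (+-mono-< i<m k<m))

  shift-zero : ∀ {i} → i < m → shift 0 i ≡ i
  shift-zero {i} i<m = trans (shift-< (subst (_< m) (sym (+-identityʳ i)) i<m)) (+-identityʳ i)

  shift-≢ : ∀ {k i} → 1 ≤ k → k < m → i < m → shift k i ≢ i
  shift-≢ {k} {i} 1≤k k<m i<m shift≡i = <⇒≢ 1≤k (sym (addMod-cancel
    (subst (AddMod m i k) shift≡i (shift-addMod k i)) (no-wrap (+-identityʳ i)) k<m (<-≤-trans z<s k<m)))

  span-addMod : ∀ (i j : Fin m) → toℕ i ≢ toℕ j → AddMod m (toℕ i) (spanIdx m i j) (toℕ j)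
  span-addMod i j i≢j with toℕ i <? toℕ j
  ... | yes i<j = no-wrap (m+[n∸m]≡n (<⇒≤ i<j))
  ... | no  i≮j = wrap (begin
    i′ + (m ∸ d)  ≡⟨ +-∸-assoc i′ d≤m ⟨
    i′ + m ∸ d    ≡⟨ cong (_∸ d) (+-comm i′ m) ⟩
    m + i′ ∸ d    ≡⟨ +-∸-assoc m (m∸n≤m i′ j′) ⟩
    m + (i′ ∸ d)  ≡⟨ cong (m +_) (m∸[m∸n]≡n (≮⇒≥ i≮j)) ⟩
    m + j′        ≡⟨ +-comm m j′ ⟩
    j′ + m        ∎)
    where
      open ≡-Reasoning
      i′ j′ d : ℕ
      i′ = toℕ i
      j′ = toℕ j
      d  = i′ ∸ j′
      d≤m : d ≤ m
      d≤m = ≤-trans (m∸n≤m i′ j′) (<⇒≤ (toℕ<n i))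

  span<m : ∀ (i j : Fin m) → toℕ i ≢ toℕ j → spanIdx m i j < m
  span<m i j i≢j with toℕ i <? toℕ j
  ... | yes _   = ≤-<-trans (m∸n≤m (toℕ j) (toℕ i)) (toℕ<n j)
  ... | no  i≮j = ∸-monoʳ-< (m<n⇒0<n∸m (≤∧≢⇒< (≮⇒≥ i≮j) (i≢j ∘ sym)))
                            (≤-trans (m∸n≤m (toℕ i) (toℕ j)) (<⇒≤ (toℕ<n i)))

  span-shift : ∀ (i j : Fin m) → toℕ i ≢ toℕ j → toℕ j ≡ shift (spanIdx m i j) (toℕ i)
  span-shift i j i≢j = addMod-unique (span-addMod i j i≢j) (shift-addMod (spanIdx m i j) (toℕ i))
    (toℕ<n j) (shift<m (span<m i j i≢j) (toℕ<n i))

  shift-span : ∀ (i j : Fin m) {k} → 1 ≤ k → k < m → toℕ j ≡ shift k (toℕ i) → spanIdx m i j ≡ k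
  shift-span i j {k} 1≤k k<m j≡shift = addMod-cancel (span-addMod i j i≢j)
    (subst (AddMod m (toℕ i) k) (sym j≡shift) (shift-addMod k (toℕ i))) (span<m i j i≢j) k<m
    where
      i≢j : toℕ i ≢ toℕ j
      i≢j i≡j = shift-≢ 1≤k k<m (toℕ<n i) (trans (sym j≡shift) (sym i≡j))

  ∏-rotate : ∀ {i} (f : ℕ → ℕ) → i < m → ∏ m (λ t → f (shift t i)) ≡ ∏ m f
  ∏-rotate {i} f i<m = begin
    ∏ m (λ t → f (shift t i))                 ≡⟨ cong (λ l → ∏ l (λ t → f (shift t i))) m≡r+i ⟩
    ∏ (r + i) (λ t → f (shift t i))           ≡⟨ ∏-split r i _ ⟩
    ∏ r (λ t → f (shift t i)) * ∏ i (λ s → f (shift (r + s) i))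
      ≡⟨ cong₂ _*_ (∏-cong r (λ t t<r → cong f (shift-t t<r)))
                   (∏-cong i (λ s _ → cong f (shift-r+s s))) ⟩
    ∏ r (λ t → f (i + t)) * ∏ i f             ≡⟨ *-comm _ (∏ i f) ⟩
    ∏ i f * ∏ r (λ t → f (i + t))             ≡⟨ ∏-split i r f ⟨
    ∏ (i + r) f                               ≡⟨ cong (λ l → ∏ l f) i+r≡m ⟩
    ∏ m f                                     ∎
    where
      open ≡-Reasoning
      r : ℕ
      r = m ∸ i
      i+r≡m : i + r ≡ m
      i+r≡m = m+[n∸m]≡n (<⇒≤ i<m)
      m≡r+i : m ≡ r + i
      m≡r+i = sym (m∸n+n≡m (<⇒≤ i<m))
      shift-t : ∀ {t} → t < r → shift t i ≡ i + t
      shift-t {t} t<r = shift-< (subst (i + t <_) i+r≡m (+-monoʳ-< i t<r))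
      shift-r+s : ∀ s → shift (r + s) i ≡ s
      shift-r+s s = begin
        shift (r + s) i  ≡⟨ shift-≥ (subst (_≤ i + (r + s)) i+r≡m (+-monoʳ-≤ i (m≤m+n r s))) ⟩
        i + (r + s) ∸ m  ≡⟨ cong (_∸ m) (trans (sym (+-assoc i r s)) (cong (_+ s) i+r≡m)) ⟩
        m + s ∸ m        ≡⟨ m+n∸m≡n m s ⟩
        s                ∎

-- Configurations of points on the cycle

module PairDistance (n : ℕ) .{{_ : NonZero n}} (pos : ℕ → ℕ) where

  open Clockwise n

  pairDist : ℕ → ℕ → ℕ
  pairDist i j with i <? j
  ... | yes _ = clockwise (pos i) (pos j) ⊓ clockwise (pos j) (pos i)
  ... | no  _ = 1

  pairDist-< : ∀ {i j} → i < j → pairDist i j ≡ clockwise (pos i) (pos j) ⊓ clockwise (pos j) (pos i)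
  pairDist-< {i} {j} i<j with i <? j
  ... | yes _   = refl
  ... | no  i≮j = ⊥-elim (i≮j i<j)

  pairDist-≮ : ∀ {i j} → ¬ i < j → pairDist i j ≡ 1
  pairDist-≮ {i} {j} i≮j with i <? j
  ... | yes i<j = ⊥-elim (i≮j i<j)
  ... | no  _   = refl

  pairDist-diag : ∀ i → pairDist i i ≡ 1
  pairDist-diag i = pairDist-≮ {i} {i} (<-irrefl refl)

  pairProduct : ℕ → ℕ
  pairProduct m = ∏ m (λ i → ∏ m (pairDist i))

pairProduct-cong : ∀ {n} .{{_ : NonZero n}} {m} {f g : ℕ → ℕ} → (∀ {i} → i < m → f i ≡ g i) →
                   PairDistance.pairProduct n f m ≡ PairDistance.pairProduct n g m
pairProduct-cong {n} {m} {f} {g} f≗g = ∏-cong m (λ i i<m → ∏-cong m (λ j j<m → pairDist-cong i<m j<m))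
  where
    open Clockwise n
    pairDist-cong : ∀ {i j} → i < m → j < m → PairDistance.pairDist n f i j ≡ PairDistance.pairDist n g i j
    pairDist-cong {i} {j} i<m j<m with i <? j
    ... | yes _ = cong₂ (λ x y → clockwise x y ⊓ clockwise y x) (f≗g i<m) (f≗g j<m)
    ... | no  _ = refl

record Ascending (n m : ℕ) (pos : ℕ → ℕ) : Set where
  field
    increasing : ∀ {i j} → i < j → j < m → pos i < pos j
    bounded    : ∀ {i} → i < m → pos i < n

module Configuration {n m : ℕ} .{{_ : NonZero n}} {pos : ℕ → ℕ} (P : Ascending n m pos) where

  open Ascending P
  open ShortArc n
  open Clockwise n
  open CyclicIndex m
  open PairDistance n pos public

  pos-mono : ∀ {i j} → i ≤ j → j < m → pos i ≤ pos j
  pos-mono i≤j j<m with m≤n⇒m<n∨m≡n i≤j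
  ... | inj₁ i<j  = <⇒≤ (increasing i<j j<m)
  ... | inj₂ refl = ≤-refl

  pos-injective : ∀ {i j} → i < m → j < m → i ≢ j → pos i ≢ pos j
  pos-injective {i} {j} i<m j<m i≢j with <-cmp i j
  ... | tri< i<j _ _ = <⇒≢ (increasing i<j j<m)
  ... | tri≈ _ i≡j _ = ⊥-elim (i≢j i≡j)
  ... | tri> _ _ j<i = ≢-sym (<⇒≢ (increasing j<i i<m))

  gap : ℕ → ℕ → ℕ
  gap k i = clockwise (pos i) (pos (shift k i))

  gap<n : ∀ k i → gap k i < n
  gap<n k i = clockwise<n (pos i) (pos (shift k i))

  gap-pos : ∀ {k i} → 1 ≤ k → k < m → i < m → 0 < gap k i
  gap-pos 1≤k k<m i<m = clockwise-pos (pos-injective i<m (shift<m k<m i<m) (≢-sym (shift-≢ 1≤k k<m i<m)))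
                                      (bounded i<m) (bounded (shift<m k<m i<m))

  gaps-centred : ∀ {k c} → 3 ≤ n → 1 ≤ k → k < m → (∀ i → i < m → Near c (gap k i)) →
                 Centred n m (gap k)
  gaps-centred {k} 3≤n 1≤k k<m =
    recentre 3≤n (≤-<-trans z≤n k<m) (λ i i<m → gap-pos 1≤k k<m i<m) (λ i _ → gap<n k i)

  gap-+-pos : ∀ {k i} → i + k < m → gap k i + pos i ≡ pos (k + i)
  gap-+-pos {k} {i} i+k<m = begin
    gap k i + pos i
      ≡⟨ cong (λ j → clockwise (pos i) (pos j) + pos i) (shift-< i+k<m) ⟩
    clockwise (pos i) (pos (i + k)) + pos i  ≡⟨ clockwise-+-≤ (pos-mono (m≤m+n i k) i+k<m) (bounded i+k<m) ⟩
    pos (i + k)                              ≡⟨ cong pos (+-comm i k) ⟩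
    pos (k + i)                              ∎
    where open ≡-Reasoning

  gap-+-pos-wrapped : ∀ {k s} → k < m → s < k → gap k (m ∸ k + s) + pos (m ∸ k + s) ≡ pos s + n
  gap-+-pos-wrapped {k} {s} k<m s<k = begin
    gap k j + pos j              ≡⟨ cong (λ i → clockwise (pos j) (pos i) + pos j) shift≡s ⟩
    clockwise (pos j) (pos s) + pos j  ≡⟨ clockwise-+-> (increasing s<j j<m) (bounded j<m) ⟩
    pos s + n                    ∎
    where
      open ≡-Reasoning
      j : ℕ
      j = m ∸ k + s
      j+k≡m+s : j + k ≡ m + s
      j+k≡m+s = trans (+-CS.xy∙z≈xz∙y (m ∸ k) s k) (cong (_+ s) (m∸n+n≡m (<⇒≤ k<m)))
      j<m : j < m
      j<m = +-cancelʳ-< k j m (subst (_< m + k) (sym j+k≡m+s) (+-monoʳ-< m s<k))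
      s<j : s < j
      s<j = m<n+m s (m<n⇒0<n∸m k<m)
      shift≡s : shift k j ≡ s
      shift≡s = trans (shift-≥ (subst (m ≤_) (sym j+k≡m+s) (m≤m+n m s)))
                      (trans (cong (_∸ m) j+k≡m+s) (m+n∸m≡n m s))

  ∑-gap : ∀ {k} → k < m → ∑ m (gap k) ≡ k * n
  ∑-gap {k} k<m = +-cancelʳ-≡ (∑ m pos) _ _ (begin
    ∑ m (gap k) + ∑ m pos                          ≡⟨ ∑-distrib m (gap k) pos ⟨
    ∑ m (λ i → gap k i + pos i)                    ≡⟨ cong (λ l → ∑ l (λ i → gap k i + pos i)) m≡r+k ⟩
    ∑ (r + k) (λ i → gap k i + pos i)              ≡⟨ ∑-split r k _ ⟩
    ∑ r (λ i → gap k i + pos i) + ∑ k (λ s → gap k (r + s) + pos (r + s))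
      ≡⟨ cong₂ _+_ (∑-cong r (λ i i<r → gap-+-pos (i+k<m i<r)))
                   (∑-cong k (λ s s<k → gap-+-pos-wrapped k<m s<k)) ⟩
    R + ∑ k (λ s → pos s + n)                      ≡⟨ cong (R +_) (∑-distrib k pos (const n)) ⟩
    R + (∑ k pos + ∑ k (const n))                  ≡⟨ cong (λ z → R + (∑ k pos + z)) (∑-const k n) ⟩
    R + (∑ k pos + k * n)                          ≡⟨ +-CS.x∙yz≈z∙yx R (∑ k pos) (k * n) ⟩
    k * n + (∑ k pos + R)                          ≡⟨ cong (k * n +_) (∑-split k r pos) ⟨
    k * n + ∑ (k + r) pos                          ≡⟨ cong (λ l → k * n + ∑ l pos) k+r≡m ⟩
    k * n + ∑ m pos                                ∎)
    where
      open ≡-Reasoning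
      r R : ℕ
      r = m ∸ k
      R = ∑ r (λ i → pos (k + i))
      m≡r+k : m ≡ r + k
      m≡r+k = sym (m∸n+n≡m (<⇒≤ k<m))
      k+r≡m : k + r ≡ m
      k+r≡m = m+[n∸m]≡n (<⇒≤ k<m)
      i+k<m : ∀ {i} → i < r → i + k < m
      i+k<m {i} i<r = subst (i + k <_) (sym m≡r+k) (+-monoˡ-< k i<r)

  pairDist-symmetrised : ∀ {i j} → i < m → j < m → i ≢ j →
                         pairDist i j * pairDist j i ≡ shortArc (clockwise (pos i) (pos j))
  pairDist-symmetrised {i} {j} i<m j<m i≢j =
    trans geodesic (geodesic≡shortArc (pos-injective i<m j<m i≢j) (bounded i<m) (bounded j<m))
    where
      cw[i,j] cw[j,i] : ℕ
      cw[i,j] = clockwise (pos i) (pos j)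
      cw[j,i] = clockwise (pos j) (pos i)
      geodesic : pairDist i j * pairDist j i ≡ cw[i,j] ⊓ cw[j,i]
      geodesic with <-cmp i j
      ... | tri< i<j _ _ = trans (cong₂ _*_ (pairDist-< i<j) (pairDist-≮ (<⇒≯ i<j))) (*-identityʳ (cw[i,j] ⊓ cw[j,i]))
      ... | tri≈ _ i≡j _ = ⊥-elim (i≢j i≡j)
      ... | tri> _ _ j<i = trans (cong₂ _*_ (pairDist-≮ (<⇒≯ j<i)) (pairDist-< j<i))
                                 (trans (*-identityˡ (cw[j,i] ⊓ cw[i,j])) (⊓-comm cw[j,i] cw[i,j]))

  gapProduct : ℕ → ℕ
  gapProduct k = ∏ m (shortArc ∘ gap k)

  gapProduct-pos : ∀ {k} → 1 ≤ k → k < m → 0 < gapProduct k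
  gapProduct-pos {k} 1≤k k<m = ∏-pos m (λ i i<m → shortArc-pos (gap-pos 1≤k k<m i<m) (gap<n k i))

  ∏-pairDist-symmetrised : ∀ {i} → i < m → ∏ m (λ j → pairDist i j * pairDist j i) ≡
                                           ∏ (pred m) (λ t → shortArc (gap (suc t) i))
  ∏-pairDist-symmetrised {i} i<m = begin
    ∏ m both                                        ≡⟨ ∏-rotate both i<m ⟨
    ∏ m (λ t → both (shift t i))
      ≡⟨ cong (λ l → ∏ l (λ t → both (shift t i))) m≡1+pred[m] ⟩
    both (shift 0 i) * ∏ (pred m) (λ t → both (shift (suc t) i))
      ≡⟨ cong₂ _*_ (cong both (shift-zero i<m))
                   (∏-cong (pred m) (λ t t<pred[m] → off-diagonal (pred-cancel-< t<pred[m]))) ⟩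
    both i * rest
      ≡⟨ cong (_* rest) (cong₂ _*_ (pairDist-diag i) (pairDist-diag i)) ⟩
    1 * rest                                        ≡⟨ *-identityˡ rest ⟩
    rest                                            ∎
    where
      open ≡-Reasoning
      both : ℕ → ℕ
      both j = pairDist i j * pairDist j i
      rest : ℕ
      rest = ∏ (pred m) (λ t → shortArc (gap (suc t) i))
      m≡1+pred[m] : m ≡ suc (pred m)
      m≡1+pred[m] = sym (suc-pred m {{>-nonZero (≤-<-trans z≤n i<m)}})
      off-diagonal : ∀ {t} → suc t < m → both (shift (suc t) i) ≡ shortArc (gap (suc t) i)
      off-diagonal st<m = pairDist-symmetrised i<m (shift<m st<m i<m) (≢-sym (shift-≢ (s≤s z≤n) st<m i<m))

  pairProduct² : pairProduct m * pairProduct m ≡ ∏ (pred m) (gapProduct ∘ suc)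
  pairProduct² = begin
    pairProduct m * pairProduct m
      ≡⟨ cong (pairProduct m *_) (∏-swap m m pairDist) ⟩
    pairProduct m * ∏ m (λ i → ∏ m (λ j → pairDist j i))
      ≡⟨ ∏-distrib m _ _ ⟨
    ∏ m (λ i → ∏ m (pairDist i) * ∏ m (λ j → pairDist j i))
      ≡⟨ ∏-cong m (λ i _ → ∏-distrib m _ _) ⟨
    ∏ m (λ i → ∏ m (λ j → pairDist i j * pairDist j i))
      ≡⟨ ∏-cong m (λ i i<m → ∏-pairDist-symmetrised i<m) ⟩
    ∏ m (λ i → ∏ (pred m) (λ t → shortArc (gap (suc t) i)))
      ≡⟨ ∏-swap m (pred m) _ ⟩
    ∏ (pred m) (gapProduct ∘ suc)
      ∎
    where open ≡-Reasoning

module Compare {n m : ℕ} .{{_ : NonZero n}} {posX posY : ℕ → ℕ}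
               (X : Ascending n m posX) (Y : Ascending n m posY) where

  open ShortArc n
  module X = Configuration X
  module Y = Configuration Y

  CentredGaps : Set
  CentredGaps = ∀ k → 1 ≤ k → k < m → Centred n m (X.gap k)

  module _ {k} (k<m : k < m) (C : Centred n m (X.gap k)) where

    open Centred C
    open Interpolation n centre 1≤centre 2+centre≤n

    private
      ∑Y≡∑X : ∑ m (Y.gap k) ≡ ∑ m (X.gap k)
      ∑Y≡∑X = trans (Y.∑-gap k<m) (sym (X.∑-gap k<m))

    gapProduct-≤ : Y.gapProduct k ≤ X.gapProduct k
    gapProduct-≤ = balanced-maximizes-∏ (λ i _ → Y.gap<n k i) near ∑Y≡∑X

    gapProduct-< : ∀ {j} → j < m → ¬ Near centre (Y.gap k j) → Y.gapProduct k < X.gapProduct k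
    gapProduct-< = balanced-maximizes-∏-strictly (λ i _ → Y.gap<n k i) near ∑Y≡∑X

  gapProducts-≤ : CentredGaps → ∀ t → t < pred m → Y.gapProduct (suc t) ≤ X.gapProduct (suc t)
  gapProducts-≤ centred t t<pred[m] = gapProduct-≤ k<m (centred (suc t) (s≤s z≤n) k<m)
    where
      k<m : suc t < m
      k<m = pred-cancel-< t<pred[m]

  pairProduct-≤ : CentredGaps → Y.pairProduct m ≤ X.pairProduct m
  pairProduct-≤ centred = square-cancel-≤ (subst₂ _≤_ (sym Y.pairProduct²) (sym X.pairProduct²)
    (∏-mono-≤ (pred m) (gapProducts-≤ centred)))

  pairProduct-< : (centred : CentredGaps) → ∀ {k} (1≤k : 1 ≤ k) (k<m : k < m) → ∀ {j} → j < m →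
                  ¬ Near (Centred.centre (centred k 1≤k k<m)) (Y.gap k j) → Y.pairProduct m < X.pairProduct m
  pairProduct-< centred {k} 1≤k k<m j<m ¬near = square-cancel-<
    (subst₂ _<_ (sym Y.pairProduct²) (sym X.pairProduct²)
      (∏-mono-< (pred m) (gapProducts-≤ centred) factor-pos (pred-mono-< k<m) factor-k-<))
    where
      instance
        k≢0 : NonZero k
        k≢0 = >-nonZero 1≤k
      factor-pos : ∀ t → t < pred m → 0 < X.gapProduct (suc t)
      factor-pos t t<pred[m] = X.gapProduct-pos (s≤s z≤n) (pred-cancel-< t<pred[m])
      factor-k-< : Y.gapProduct (suc (pred k)) < X.gapProduct (suc (pred k))
      factor-k-< = subst (λ k → Y.gapProduct k < X.gapProduct k) (sym (suc-pred k))
                         (gapProduct-< k<m (centred k 1≤k k<m) j<m ¬near)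

module EvenlySpaced (n m : ℕ) .{{_ : NonZero n}} .{{_ : NonZero m}} (m≤n : m ≤ n) where

  open Clockwise n
  open CyclicIndex m

  spread : ℕ → ℕ
  spread i = i * n / m

  spread-ascending : Ascending n m spread
  spread-ascending = record { increasing = increasing ; bounded = bounded }
    where
      open ≤-Reasoning
      increasing : ∀ {i j} → i < j → j < m → spread i < spread j
      increasing {i} {j} i<j _ = m*n≤o⇒m≤o/n m (begin
        suc (spread i) * m  ≡⟨⟩
        m + spread i * m    ≤⟨ +-mono-≤ m≤n (m/n*n≤m (i * n) m) ⟩
        n + i * n           ≡⟨⟩
        suc i * n           ≤⟨ *-monoˡ-≤ n i<j ⟩
        j * n               ∎)
      bounded : ∀ {i} → i < m → spread i < n
      bounded {i} i<m = m<n*o⇒m/o<n (subst (i * n <_) (*-comm m n) (*-monoˡ-< n i<m))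

  open Ascending spread-ascending
  open Configuration spread-ascending using (gap; pos-mono)

  spread-+-gap : ∀ {k i} → k < m → i < m → spread i + gap k i ≡ (i * n + k * n) / m
  spread-+-gap {k} {i} k<m i<m with shift k i | shift<m k<m i<m | shift-addMod k i
  ... | j | j<m | no-wrap i+k≡j = begin
    spread i + clockwise (spread i) (spread j)  ≡⟨ +-comm (spread i) _ ⟩
    clockwise (spread i) (spread j) + spread i  ≡⟨ clockwise-+-≤ (pos-mono i≤j j<m) (bounded j<m) ⟩
    j * n / m                                   ≡⟨ cong (λ x → x * n / m) i+k≡j ⟨
    (i + k) * n / m                             ≡⟨ cong (_/ m) (*-distribʳ-+ n i k) ⟩
    (i * n + k * n) / m                         ∎
    where
      open ≡-Reasoning
      i≤j : i ≤ j
      i≤j = subst (i ≤_) i+k≡j (m≤m+n i k)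
  ... | j | j<m | wrap i+k≡j+m = begin
    spread i + clockwise (spread i) (spread j)  ≡⟨ +-comm (spread i) _ ⟩
    clockwise (spread i) (spread j) + spread i  ≡⟨ clockwise-+-> (increasing j<i i<m) (bounded i<m) ⟩
    j * n / m + n                               ≡⟨ cong (j * n / m +_) (m*n/n≡m n m) ⟨
    j * n / m + n * m / m                       ≡⟨ +-distrib-/-∣ʳ (j * n) (n∣m*n n) ⟨
    (j * n + n * m) / m                         ≡⟨ cong (λ x → (j * n + x) / m) (*-comm n m) ⟩
    (j * n + m * n) / m                         ≡⟨ cong (_/ m) (*-distribʳ-+ n j m) ⟨
    (j + m) * n / m                             ≡⟨ cong (λ x → x * n / m) i+k≡j+m ⟨
    (i + k) * n / m                             ≡⟨ cong (_/ m) (*-distribʳ-+ n i k) ⟩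
    (i * n + k * n) / m                         ∎
    where
      open ≡-Reasoning
      j<i : j < i
      j<i = +-cancelʳ-< m j i (subst (_< i + m) i+k≡j+m (+-monoʳ-< i k<m))

  spread-gap : ∀ {k i} → k < m → i < m → Near (k * n / m) (gap k i)
  spread-gap {k} {i} k<m i<m =
    Near-cancelˡ (spread i) (subst (Near _) (sym (spread-+-gap k<m i<m)) ([m+n]/o-Near m (i * n) (k * n)))

-- Subsets of the cycle

at : List ℕ → ℕ → ℕ
at []       _       = 0
at (x ∷ _)  zero    = x
at (_ ∷ xs) (suc i) = at xs i

at-map : ∀ (f : ℕ → ℕ) (xs : List ℕ) {i} → i < length xs → at (map f xs) i ≡ f (at xs i)
at-map f (x ∷ xs) {zero}  _         = refl
at-map f (x ∷ xs) {suc i} (s<s i<l) = at-map f xs i<l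

lookup-at : ∀ {n} (xs : List (Fin n)) (i : Fin (length xs)) → toℕ (lookup xs i) ≡ at (map toℕ xs) (toℕ i)
lookup-at (x ∷ xs) fzero    = refl
lookup-at (x ∷ xs) (fsuc i) = lookup-at xs i

product-concatMap : ∀ {A : Set} {m} (f : Fin m → A) (g : A → List ℕ) (v : ℕ → ℕ) →
                    (∀ i → product (g (f i)) ≡ v (toℕ i)) → product (concatMap g (tabulate f)) ≡ ∏ m v
product-concatMap {m = zero}  f g v eq = refl
product-concatMap {m = suc m} f g v eq = trans (product-++ (g (f fzero)) _)
  (cong₂ _*_ (eq fzero) (product-concatMap (f ∘ fsuc) g (v ∘ suc) (eq ∘ fsuc)))

All-concatMap⁺ : ∀ {A : Set} {P : ℕ → Set} {m} (f : Fin m → A) (g : A → List ℕ) →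
                 (∀ i → All P (g (f i))) → All P (concatMap g (tabulate f))
All-concatMap⁺ f g all = concat⁺ (map⁺ (tabulate⁺ all))

All-concatMap⁻ : ∀ {A : Set} {P : ℕ → Set} {m} (f : Fin m → A) (g : A → List ℕ) →
                 All P (concatMap g (tabulate f)) → ∀ i → All P (g (f i))
All-concatMap⁻ f g all = tabulate⁻ (map⁻ (concat⁻ all))

ascending-resp : ∀ {n m m′} {f g : ℕ → ℕ} → m ≡ m′ → (∀ {i} → i < m → f i ≡ g i) →
                 Ascending n m f → Ascending n m′ g
ascending-resp {n} {f = f} {g} refl f≗g P = record
  { increasing = λ i<j j<m → subst₂ _<_ (f≗g (<-trans i<j j<m)) (f≗g j<m) (increasing i<j j<m)
  ; bounded    = λ i<m → subst (_< n) (f≗g i<m) (bounded i<m) }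
  where open Ascending P

ascending-tail : ∀ {n m pos} → Ascending n (suc m) pos → Ascending n m (pos ∘ suc)
ascending-tail P = record
  { increasing = λ i<j j<m → increasing (s<s i<j) (s<s j<m) ; bounded = λ i<m → bounded (s<s i<m) }
  where open Ascending P

ascending-pred : ∀ {n m pos} → Ascending (suc n) m pos → (∀ {i} → i < m → 1 ≤ pos i) →
                 Ascending n m (pred ∘ pos)
ascending-pred P 1≤pos = record
  { increasing = λ i<j j<m → pred-mono-< {{>-nonZero (1≤pos (<-trans i<j j<m))}} (increasing i<j j<m)
  ; bounded    = λ i<m → pred-< (1≤pos i<m) (bounded i<m) }
  where
    open Ascending P
    pred-< : ∀ {x n} → 1 ≤ x → x < suc n → pred x < n
    pred-< (s≤s _) (s≤s x<n) = x<n

positions : ∀ {n} → Subset n → List ℕ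
positions X = map toℕ (elems X)

module _ {n} (X : Subset n) where

  filter-map-fsuc : ∀ s (xs : List (Fin n)) →
                    filter (λ i → i ∈? s ∷ X) (map fsuc xs) ≡ map fsuc (filter (λ i → i ∈? X) xs)
  filter-map-fsuc s []       = refl
  filter-map-fsuc s (x ∷ xs) with x ∈? X
  ... | yes _ = cong (fsuc x ∷_) (filter-map-fsuc s xs)
  ... | no  _ = filter-map-fsuc s xs

  elems-inside : elems (inside ∷ X) ≡ fzero ∷ map fsuc (elems X)
  elems-inside =
    cong (fzero ∷_) (trans (cong (filter _) (sym (map-tabulate id fsuc))) (filter-map-fsuc inside (allFin n)))

  elems-outside : elems (outside ∷ X) ≡ map fsuc (elems X)
  elems-outside = trans (cong (filter _) (sym (map-tabulate id fsuc))) (filter-map-fsuc outside (allFin n))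

  length-elems-inside : length (elems (inside ∷ X)) ≡ suc (length (elems X))
  length-elems-inside = trans (cong length elems-inside) (cong suc (length-map fsuc (elems X)))

  length-elems-outside : length (elems (outside ∷ X)) ≡ length (elems X)
  length-elems-outside = trans (cong length elems-outside) (length-map fsuc (elems X))

  at-positions-fsuc : ∀ {xs i} → xs ≡ map fsuc (elems X) → i < length (elems X) →
                      at (map toℕ xs) i ≡ suc (at (positions X) i)
  at-positions-fsuc {i = i} refl i<m =
    trans (cong (λ ys → at ys i) (trans (sym (map-∘ (elems X))) (map-∘ (elems X))))
          (at-map suc (positions X) (subst (i <_) (sym (length-map toℕ (elems X))) i<m))

  at-positions-inside : ∀ {i} → i < length (elems X) →
                        at (positions (inside ∷ X)) (suc i) ≡ suc (at (positions X) i)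
  at-positions-inside {i} i<m =
    trans (cong (λ xs → at (map toℕ xs) (suc i)) elems-inside) (at-positions-fsuc refl i<m)

  at-positions-outside : ∀ {i} → i < length (elems X) →
                         at (positions (outside ∷ X)) i ≡ suc (at (positions X) i)
  at-positions-outside i<m = at-positions-fsuc elems-outside i<m

length-elems : ∀ {n} (X : Subset n) → length (elems X) ≡ ∣ X ∣
length-elems []            = refl
length-elems (inside ∷ X)  = trans (length-elems-inside X) (cong suc (length-elems X))
length-elems (outside ∷ X) = trans (length-elems-outside X) (length-elems X)

positions-ascending : ∀ {n} (X : Subset n) → Ascending n (length (elems X)) (at (positions X))
positions-ascending [] = record { increasing = λ _ () ; bounded = λ () }
positions-ascending {suc n} (inside ∷ X) = record { increasing = increasing′ ; bounded = bounded′ }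
  where
    open Ascending (positions-ascending X)
    shrink : ∀ {i} → suc i < length (elems (inside ∷ X)) → i < length (elems X)
    shrink {i} si<m = s<s⁻¹ (subst (suc i <_) (length-elems-inside X) si<m)
    increasing′ : ∀ {i j} → i < j → j < length (elems (inside ∷ X)) →
                  at (positions (inside ∷ X)) i < at (positions (inside ∷ X)) j
    increasing′ {zero}  {suc j} _         sj<m = subst (0 <_) (sym (at-positions-inside X (shrink sj<m))) z<s
    increasing′ {suc i} {suc j} (s<s i<j) sj<m = subst₂ _<_
      (sym (at-positions-inside X (<-trans i<j (shrink sj<m)))) (sym (at-positions-inside X (shrink sj<m)))
      (s<s (increasing i<j (shrink sj<m)))
    bounded′ : ∀ {i} → i < length (elems (inside ∷ X)) → at (positions (inside ∷ X)) i < suc n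
    bounded′ {zero}  _    = z<s
    bounded′ {suc i} si<m =
      subst (_< suc n) (sym (at-positions-inside X (shrink si<m))) (s<s (bounded (shrink si<m)))
positions-ascending {suc n} (outside ∷ X) = record { increasing = increasing′ ; bounded = bounded′ }
  where
    open Ascending (positions-ascending X)
    shrink : ∀ {i} → i < length (elems (outside ∷ X)) → i < length (elems X)
    shrink {i} = subst (i <_) (length-elems-outside X)
    increasing′ : ∀ {i j} → i < j → j < length (elems (outside ∷ X)) →
                  at (positions (outside ∷ X)) i < at (positions (outside ∷ X)) j
    increasing′ i<j j<m = subst₂ _<_
      (sym (at-positions-outside X (<-trans i<j (shrink j<m)))) (sym (at-positions-outside X (shrink j<m)))
      (s<s (increasing i<j (shrink j<m)))
    bounded′ : ∀ {i} → i < length (elems (outside ∷ X)) → at (positions (outside ∷ X)) i < suc n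
    bounded′ i<m = subst (_< suc n) (sym (at-positions-outside X (shrink i<m))) (s<s (bounded (shrink i<m)))

Realises : ∀ n m → (ℕ → ℕ) → Subset n → Set
Realises n m pos X = length (elems X) ≡ m × (∀ {i} → i < m → at (positions X) i ≡ pos i)

mutual
  realise : ∀ n {m pos} → Ascending n m pos → Σ (Subset n) (Realises n m pos)
  realise zero    {zero}        _ = [] , refl , λ ()
  realise zero    {suc m}       P = ⊥-elim (n≮0 (Ascending.bounded P z<s))
  realise (suc n) {zero}        P = realise-outside n P (λ ())
  realise (suc n) {suc m} {pos} P with pos 0 in pos0≡
  ... | zero  = realise-inside n P pos0≡
  ... | suc _ = realise-outside n P (λ i<m → ≤-trans (≤-trans (s≤s z≤n) (≤-reflexive (sym pos0≡)))
                                                     (Configuration.pos-mono P z≤n i<m))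

  realise-outside : ∀ n {m pos} → Ascending (suc n) m pos → (∀ {i} → i < m → 1 ≤ pos i) →
                    Σ (Subset (suc n)) (Realises (suc n) m pos)
  realise-outside n {m} {pos} P 1≤pos = outside ∷ X , trans (length-elems-outside X) |X|≡m , at≡pos
    where
      rec : Σ (Subset n) (Realises n m (pred ∘ pos))
      rec = realise n (ascending-pred P 1≤pos)
      X : Subset n
      X = proj₁ rec
      |X|≡m : length (elems X) ≡ m
      |X|≡m = proj₁ (proj₂ rec)
      at≡pos : ∀ {i} → i < m → at (positions (outside ∷ X)) i ≡ pos i
      at≡pos {i} i<m = begin
        at (positions (outside ∷ X)) i  ≡⟨ at-positions-outside X (subst (i <_) (sym |X|≡m) i<m) ⟩
        suc (at (positions X) i)        ≡⟨ cong suc (proj₂ (proj₂ rec) i<m) ⟩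
        suc (pred (pos i))              ≡⟨ suc-pred (pos i) {{>-nonZero (1≤pos i<m)}} ⟩
        pos i                           ∎
        where open ≡-Reasoning

  realise-inside : ∀ n {m pos} → Ascending (suc n) (suc m) pos → pos 0 ≡ 0 →
                   Σ (Subset (suc n)) (Realises (suc n) (suc m) pos)
  realise-inside n {m} {pos} P pos0≡0 = inside ∷ X , trans (length-elems-inside X) (cong suc |X|≡m) , at≡pos
    where
      1≤pos∘suc : ∀ {i} → i < m → 1 ≤ pos (suc i)
      1≤pos∘suc i<m = subst (_< pos (suc _)) pos0≡0 (Ascending.increasing P z<s (s<s i<m))
      rec : Σ (Subset n) (Realises n m (pred ∘ pos ∘ suc))
      rec = realise n (ascending-pred (ascending-tail P) 1≤pos∘suc)
      X : Subset n
      X = proj₁ rec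
      |X|≡m : length (elems X) ≡ m
      |X|≡m = proj₁ (proj₂ rec)
      at≡pos : ∀ {i} → i < suc m → at (positions (inside ∷ X)) i ≡ pos i
      at≡pos {zero}  _         = sym pos0≡0
      at≡pos {suc i} (s<s i<m) = begin
        at (positions (inside ∷ X)) (suc i)  ≡⟨ at-positions-inside X (subst (i <_) (sym |X|≡m) i<m) ⟩
        suc (at (positions X) i)             ≡⟨ cong suc (proj₂ (proj₂ rec) i<m) ⟩
        suc (pred (pos (suc i)))             ≡⟨ suc-pred (pos (suc i)) {{>-nonZero (1≤pos∘suc i<m)}} ⟩
        pos (suc i)                          ∎
        where open ≡-Reasoning

module SubsetConfiguration {n : ℕ} .{{_ : NonZero n}} (X : Subset n) where

  open Clockwise n
  open CyclicIndex (length (elems X))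
  open Configuration (positions-ascending X) public

  -- `F` and `sigmaStar` inspect pairs through functions local to their definitions; naming their
  -- types by unification lets us case-split on the comparisons those functions perform.
  mutual
    PairEntry : (i j : Fin (length (elems X))) → List ℕ
    PairEntry i j = _

    F-unfold : F n X ≡ product (concatMap (λ i → concatMap (PairEntry i) (allFin _)) (allFin _))
    F-unfold = refl

  mutual
    SigmaEntry : ℕ → (i j : Fin (length (elems X))) → List ℕ
    SigmaEntry k i j = _

    sigmaStar-unfold : ∀ k →
                       sigmaStar n X k ≡ concatMap (λ i → concatMap (SigmaEntry k i) (allFin _)) (allFin _)
    sigmaStar-unfold k = refl

  F≡pairProduct : F n X ≡ pairProduct (length (elems X))
  F≡pairProduct = trans F-unfold
    (product-concatMap id _ _ (λ i → product-concatMap id _ _ (λ j → pairEntry-product i j)))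
    where
      pairEntry-product : ∀ i j → product (PairEntry i j) ≡ pairDist (toℕ i) (toℕ j)
      pairEntry-product i j with toℕ i <? toℕ j
      ... | yes _ = trans (*-identityʳ _)
                      (cong₂ (λ x y → clockwise x y ⊓ clockwise y x) (lookup-at (elems X) i) (lookup-at (elems X) j))
      ... | no  _ = refl

  dstar-lookup : ∀ i j {k} → toℕ j ≡ shift k (toℕ i) →
                 dstar n (lookup (elems X) i) (lookup (elems X) j) ≡ gap k (toℕ i)
  dstar-lookup i j j≡shift =
    cong₂ clockwise (lookup-at (elems X) i) (trans (lookup-at (elems X) j) (cong (at (positions X)) j≡shift))

  gaps⇒sigmaStar : ∀ {P : ℕ → Set} k → (∀ i → i < length (elems X) → P (gap k i)) →
                   All P (sigmaStar n X k)
  gaps⇒sigmaStar {P} k all =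
    subst (All P) (sym (sigmaStar-unfold k)) (All-concatMap⁺ id _ (λ i → All-concatMap⁺ id _ (entry i)))
    where
      entry : ∀ i j → All P (SigmaEntry k i j)
      entry i j with toℕ i ≟ toℕ j
      ... | yes _   = []
      ... | no  i≢j with spanIdx (length (elems X)) i j ≟ k
      ...   | yes refl = subst P (sym (dstar-lookup i j (span-shift i j i≢j))) (all (toℕ i) (toℕ<n i)) ∷ []
      ...   | no  _    = []

  sigmaEntry-hit : ∀ k i j → toℕ i ≢ toℕ j → spanIdx (length (elems X)) i j ≡ k →
                   SigmaEntry k i j ≡ dstar n (lookup (elems X) i) (lookup (elems X) j) ∷ []
  sigmaEntry-hit k i j i≢j span≡k with toℕ i ≟ toℕ j
  ... | yes i≡j = ⊥-elim (i≢j i≡j)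
  ... | no  _ with spanIdx (length (elems X)) i j ≟ k
  ...   | yes _      = refl
  ...   | no  span≢k = ⊥-elim (span≢k span≡k)

  sigmaStar⇒gaps : ∀ {P : ℕ → Set} {k} → 1 ≤ k → k < length (elems X) → All P (sigmaStar n X k) →
                   ∀ i → i < length (elems X) → P (gap k i)
  sigmaStar⇒gaps {P} {k} 1≤k k<m all i i<m =
    subst P (trans (dstar-lookup i′ j′ j′≡shift) (cong (gap k) i′≡i)) p
    where
      i′ j′ : Fin (length (elems X))
      i′ = fromℕ< i<m
      j′ = fromℕ< (shift<m k<m i<m)
      i′≡i : toℕ i′ ≡ i
      i′≡i = toℕ-fromℕ< i<m
      j′≡shift : toℕ j′ ≡ shift k (toℕ i′)
      j′≡shift = trans (toℕ-fromℕ< (shift<m k<m i<m)) (cong (shift k) (sym i′≡i))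
      i′≢j′ : toℕ i′ ≢ toℕ j′
      i′≢j′ i′≡j′ = shift-≢ 1≤k k<m (toℕ<n i′) (trans (sym j′≡shift) (sym i′≡j′))
      entry : All P (SigmaEntry k i′ j′)
      entry = All-concatMap⁻ id _ (All-concatMap⁻ id _ (subst (All P) (sigmaStar-unfold k) all) i′) j′
      p : P (dstar n (lookup (elems X) i′) (lookup (elems X) j′))
      p with subst (All P) (sigmaEntry-hit k i′ j′ i′≢j′ (shift-span i′ j′ 1≤k k<m j′≡shift)) entry
      ... | p ∷ [] = p

F≡pairProduct-at : ∀ {n} .{{_ : NonZero n}} (X : Subset n) {m} → length (elems X) ≡ m →
                   F n X ≡ PairDistance.pairProduct n (at (positions X)) m
F≡pairProduct-at X refl = SubsetConfiguration.F≡pairProduct X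

maximallyEven⇒maximizer : ∀ n .{{_ : NonZero n}} → 3 ≤ n → (A : Subset n) →
                          MaximallyEven n A → IsFMaximizer n A
maximallyEven⇒maximizer n 3≤n A even B |B|≡|A| = begin
  F n B                                       ≡⟨ F≡pairProduct-at B mB≡mA ⟩
  pairProduct n (at (positions B)) m          ≤⟨ pairProduct-≤ centred ⟩
  pairProduct n (at (positions A)) m          ≡⟨ F≡pairProduct-at A refl ⟨
  F n A                                       ∎
  where
    open ≤-Reasoning
    open PairDistance using (pairProduct)
    module A = SubsetConfiguration A
    m : ℕ
    m = length (elems A)
    mB≡mA : length (elems B) ≡ m
    mB≡mA = trans (length-elems B) (trans |B|≡|A| (sym (length-elems A)))
    open Compare (positions-ascending A) (ascending-resp mB≡mA (λ _ → refl) (positions-ascending B))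
    centred : CentredGaps
    centred k 1≤k k<m = A.gaps-centred 3≤n 1≤k k<m
      (A.sigmaStar⇒gaps 1≤k k<m (proj₂ (even k 1≤k (subst (k <_) (length-elems A) k<m))))

maximizer⇒maximallyEven : ∀ n .{{_ : NonZero n}} → 3 ≤ n → (A : Subset n) →
                          IsFMaximizer n A → MaximallyEven n A
maximizer⇒maximallyEven n 3≤n A maximal k 1≤k k<|A| =
  Centred.centre (centred k 1≤k k<m) , A.gaps⇒sigmaStar k near
  where
    module A = SubsetConfiguration A
    m : ℕ
    m = length (elems A)
    k<m : k < m
    k<m = subst (k <_) (sym (length-elems A)) k<|A|
    instance
      m≢0 : NonZero m
      m≢0 = >-nonZero (≤-<-trans z≤n k<m)
    open EvenlySpaced n m (subst (_≤ n) (sym (length-elems A)) (∣p∣≤n A))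
    open Compare spread-ascending (positions-ascending A)
    centred : CentredGaps
    centred k 1≤k k<m = X.gaps-centred 3≤n 1≤k k<m (λ i i<m → spread-gap k<m i<m)
    E : Subset n
    E = proj₁ (realise n spread-ascending)
    E-realises : Realises n m spread E
    E-realises = proj₂ (realise n spread-ascending)
    F[E]≤F[A] : X.pairProduct m ≤ Y.pairProduct m
    F[E]≤F[A] = begin
      X.pairProduct m                                  ≡⟨ pairProduct-cong (proj₂ E-realises) ⟨
      PairDistance.pairProduct n (at (positions E)) m  ≡⟨ F≡pairProduct-at E (proj₁ E-realises) ⟨
      F n E                                            ≤⟨ maximal E |E|≡|A| ⟩
      F n A                                            ≡⟨ A.F≡pairProduct ⟩
      Y.pairProduct m                                  ∎
      where
        open ≤-Reasoning
        |E|≡|A| : ∣ E ∣ ≡ ∣ A ∣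
        |E|≡|A| = trans (sym (length-elems E)) (trans (proj₁ E-realises) (length-elems A))
    -- a gap of A off the centre of the evenly spaced set would make F A < F E
    near : ∀ i → i < m → Near (Centred.centre (centred k 1≤k k<m)) (A.gap k i)
    near i i<m = decidable-stable (Near? _ _)
      (λ ¬near → <⇒≱ (pairProduct-< centred 1≤k k<m i<m ¬near) F[E]≤F[A])

corollary2p17 : (n : ℕ) .{{_ : NonZero n}} → 3 ≤ n → (A : Subset n) →
    (MaximallyEven n A → IsFMaximizer n A) × (IsFMaximizer n A → MaximallyEven n A)
corollary2p17 n 3≤n A = maximallyEven⇒maximizer n 3≤n A , maximizer⇒maximallyEven n 3≤n A
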